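{- Let $G \simeq C_{n_1} \oplus \dots \oplus C_{n_r}$ with integers $1 < n_1 \mid n_2 \mid \dots \mid n_r$. Suppose that every zero-sumfree sequence $S$ in $G$ with $|S| \geq \sum_{i=1}^r (n_i-1)$ satisfies $\mathsf{k}(S) \leq \sum_{i=1}^r \frac{n_i-1}{n_i}$. Then $$\mathsf{D}(G) \leq \sum_{i=1}^r \frac{n_r}{n_i}(n_i-1)+1 = \Big(\sum_{i=1}^r (n_i-1)+1\Big) + \sum_{i=1}^r \Big(\frac{n_r}{n_i}-1\Big)(n_i-1).$$
   Context: $C_k$ denotes the cyclic group of order $k$. A sequence in a finite abelian group $G$ (written additively) is a finite list $S=(g_1,\dots,g_\ell)$ of elements of $G$ (repetitions allowed), of length $|S|=\ell$. $S$ is zero-sumfree if $\sum_{i\in I} g_i \neq 0$ for every non-empty $I \subseteq \{1,\dots,\ell\}$. The cross number of $S$ is $\mathsf{k}(S)=\sum_{i=1}^{\ell} \frac{1}{\mathrm{ord}(g_i)}$. The Davenport constant $\mathsf{D}(G)$ is the smallest positive integer $t$ such that every sequence in $G$ of length at least $t$ has a non-empty subsequence with sum $0$. -}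

module Defs where

open import Data.Nat using (ℕ; zero; suc; _+_; _*_; _∸_; _≤_; _<_)
open import Data.Nat.DivMod using (_/_)
open import Data.Nat.Divisibility using (_∣_)
open import Data.Integer using (+_)
open import Data.Rational.Unnormalised using (ℚᵘ; mkℚᵘ; 0ℚᵘ) renaming (_+_ to _+ℚ_)
open import Data.Fin using (Fin; zero; suc)
open import Data.Fin.Subset using (Subset; Nonempty)
open import Data.Vec using (Vec; []; _∷_; lookup)
open import Data.Bool using (true; false)
open import Data.Product using (_×_; Σ)
open import Relation.Nullary using (¬_)

ΣFin : ∀ {m} → (Fin m → ℕ) → ℕ
ΣFin {zero} f = 0
ΣFin {suc m} f = f zero + ΣFin (λ i → f (suc i))

ΣFinℚ : ∀ {m} → (Fin m → ℚᵘ) → ℚᵘ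
ΣFinℚ {zero} f = 0ℚᵘ
ΣFinℚ {suc m} f = f zero +ℚ ΣFinℚ (λ i → f (suc i))

-- a ÷ b is the rational a/b (meaningful for b ≥ 1)
_÷_ : ℕ → ℕ → ℚᵘ
a ÷ b = mkℚᵘ (+ a) (b ∸ 1)

-- natural division, total (only used with nonzero exact divisors)
quot : ℕ → ℕ → ℕ
quot m zero = 0
quot m (suc d) = m / suc d

-- The group G = C_{n 0} ⊕ ... ⊕ C_{n (r-1)}; an element is represented by
-- a tuple of natural numbers, the i-th component taken modulo n i.
module Group {r : ℕ} (n : Fin r → ℕ) where

  Elem : Set
  Elem = Fin r → ℕ

  _⊕_ : Elem → Elem → Elem
  (g ⊕ h) i = g i + h i

  0G : Elem
  0G i = 0

  IsZero : Elem → Set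
  IsZero g = ∀ i → n i ∣ g i

  _•_ : ℕ → Elem → Elem
  (k • g) i = k * g i

  IsOrder : Elem → ℕ → Set
  IsOrder g k = (0 < k) × IsZero (k • g) × (∀ m → 0 < m → IsZero (m • g) → k ≤ m)

  subsum : ∀ {ℓ} → Vec Elem ℓ → Subset ℓ → Elem
  subsum [] [] = 0G
  subsum (g ∷ S) (true ∷ I) = g ⊕ subsum S I
  subsum (g ∷ S) (false ∷ I) = subsum S I

  ZeroSumFree : ∀ {ℓ} → Vec Elem ℓ → Set
  ZeroSumFree {ℓ} S = (I : Subset ℓ) → Nonempty I → ¬ IsZero (subsum S I)

  -- cross number of a sequence whose element orders are listed in ords
  crossOf : ∀ {ℓ} → Vec ℕ ℓ → ℚᵘ
  crossOf {ℓ} ords = ΣFinℚ (λ j → 1 ÷ lookup ords j)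

  HasOrders : ∀ {ℓ} → Vec Elem ℓ → Vec ℕ ℓ → Set
  HasOrders {ℓ} S ords = (j : Fin ℓ) → IsOrder (lookup S j) (lookup ords j)

  DavenportProp : ℕ → Set
  DavenportProp t = ∀ ℓ → t ≤ ℓ → (S : Vec Elem ℓ) →
                    Σ (Subset ℓ) (λ I → Nonempty I × IsZero (subsum S I))

  IsDavenport : ℕ → Set
  IsDavenport t = (1 ≤ t) × DavenportProp t × (∀ t' → 1 ≤ t' → DavenportProp t' → t ≤ t')

module Submission where

-- Put N = n_r and T = Σ_i (N / n_i)(n_i - 1).
-- Since every n_i divides N, every element g of G satisfies N·g = 0, so its
-- order is at most N and every term of a sequence contributes at least 1/N to
-- its cross number: k(S) ≥ |S| / N.  On the other side, writing each
-- (n_i - 1)/n_i over the common denominator N gives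
-- Σ_i (n_i - 1)/n_i = T / N.  Hence a zero-sumfree sequence S of length
-- |S| ≥ Σ_i (n_i - 1) satisfies |S| / N ≤ k(S) ≤ T / N by hypothesis, i.e.
-- |S| ≤ T; shorter sequences satisfy |S| ≤ T trivially.  So every sequence of
-- length T + 1 has a non-empty zero-sum subsequence, and D(G) ≤ T + 1.

open import Defs
open import Data.Nat using (ℕ; zero; suc; _+_; _*_; _∸_; _≤_; _<_; z≤n; s≤s; _≤?_; >-nonZero)
import Data.Nat.Properties as ℕP
open import Data.Nat.Divisibility using (_∣_; _∣?_; ∣-trans; ∣-refl; m∣m*n)
open import Data.Nat.DivMod using (m/n*n≡m)
open import Data.Nat.Tactic.RingSolver using (solve-∀)
open import Data.Integer as ℤ using (+_; +≤+)
open import Data.Integer.Properties using (pos-*; pos-+; drop‿+≤+)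
open import Data.Rational.Unnormalised using (mkℚᵘ; *≤*; *≡*; _≃_)
  renaming (_≤_ to _≤ℚ_; _+_ to _+ℚ_)
import Data.Rational.Unnormalised.Properties as ℚP
open import Data.Fin using (Fin; zero; suc; inject₁; fromℕ)
open import Data.Fin.Subset using (Subset; Nonempty)
open import Data.Fin.Subset.Properties using (anySubset?; nonempty?)
open import Data.Fin.Properties using (all?)
open import Data.Vec using (Vec; lookup; tabulate)
open import Data.Vec.Properties using (lookup∘tabulate)
open import Data.Product using (Σ; ∃; _×_; _,_; proj₁; proj₂)
open import Data.Sum using (_⊎_; inj₁; inj₂)
open import Relation.Nullary using (¬_; Dec; yes; no; contradiction)
open import Relation.Nullary.Decidable using (_×-dec_)
open import Relation.Binary.PropositionalEquality

÷-≤ : ∀ a b c d → a * suc d ≤ c * suc b → a ÷ suc b ≤ℚ c ÷ suc d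
÷-≤ a b c d ad≤cb = *≤* (subst₂ ℤ._≤_ (pos-* a (suc d)) (pos-* c (suc b)) (+≤+ ad≤cb))

÷-≤⁻¹ : ∀ a b c d → a ÷ suc b ≤ℚ c ÷ suc d → a * suc d ≤ c * suc b
÷-≤⁻¹ a b c d (*≤* ad≤cb) =
  drop‿+≤+ (subst₂ ℤ._≤_ (sym (pos-* a (suc d))) (sym (pos-* c (suc b))) ad≤cb)

÷-≃ : ∀ a b c d → a * suc d ≡ c * suc b → a ÷ suc b ≃ c ÷ suc d
÷-≃ a b c d ad≡cb = *≡* (trans (sym (pos-* a (suc d))) (trans (cong +_ ad≡cb) (pos-* c (suc b))))

÷-cancel : ∀ a c {N} → 0 < N → a ÷ N ≤ℚ c ÷ N → a ≤ c
÷-cancel a c {suc N} _ a/N≤c/N = ℕP.*-cancelʳ-≤ a c (suc N) (÷-≤⁻¹ a N c N a/N≤c/N)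

÷-+ : ∀ a m c n → a ÷ suc m +ℚ c ÷ suc n ≡ (a * suc n + c * suc m) ÷ (suc m * suc n)
÷-+ a m c n = cong (λ z → mkℚᵘ z (n + m * suc n))
  (sym (trans (pos-+ (a * suc n) (c * suc m)) (cong₂ ℤ._+_ (pos-* a (suc n)) (pos-* c (suc m)))))

quot-*-cancel : ∀ {b N} → 0 < b → b ∣ N → quot N b * b ≡ N
quot-*-cancel {suc b} _ b∣N = m/n*n≡m b∣N

quot-positive : ∀ {b N} → 0 < b → 0 < N → b ∣ N → 0 < quot N b
quot-positive {b} {suc N} b>0 _ b∣N with quot (suc N) b | quot-*-cancel b>0 b∣N
... | suc _ | _ = s≤s z≤n
... | zero | ()

÷-expand : ∀ a {b N} → 0 < b → 0 < N → b ∣ N → a ÷ b ≃ (quot N b * a) ÷ N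
÷-expand a {suc b} {suc N} b>0 _ b∣N = ÷-≃ a b (q * a) N (begin
    a * suc N        ≡⟨ cong (a *_) (sym (quot-*-cancel b>0 b∣N)) ⟩
    a * (q * suc b)  ≡⟨ sym (ℕP.*-assoc a q (suc b)) ⟩
    a * q * suc b    ≡⟨ cong (_* suc b) (ℕP.*-comm a q) ⟩
    q * a * suc b    ∎)
  where
  open ≡-Reasoning
  q = quot (suc N) (suc b)

ΣFin-mono : ∀ {m} (f g : Fin m → ℕ) → (∀ i → f i ≤ g i) → ΣFin f ≤ ΣFin g
ΣFin-mono {zero} f g f≤g = z≤n
ΣFin-mono {suc m} f g f≤g =
  ℕP.+-mono-≤ (f≤g zero) (ΣFin-mono (λ i → f (suc i)) (λ i → g (suc i)) (λ i → f≤g (suc i)))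

ΣFinℚ-mono : ∀ {m} f g → (∀ (i : Fin m) → f i ≤ℚ g i) → ΣFinℚ f ≤ℚ ΣFinℚ g
ΣFinℚ-mono {zero} f g f≤g = ℚP.≤-refl
ΣFinℚ-mono {suc m} f g f≤g =
  ℚP.+-mono-≤ (f≤g zero) (ΣFinℚ-mono (λ i → f (suc i)) (λ i → g (suc i)) (λ i → f≤g (suc i)))

ΣFin-ones : ∀ m → ΣFin {m} (λ _ → 1) ≡ m
ΣFin-ones zero = refl
ΣFin-ones (suc m) = cong suc (ΣFin-ones m)

ΣFinℚ-÷ : ∀ N {m} (f : Fin m → ℕ) → ΣFinℚ (λ i → f i ÷ suc N) ≃ ΣFin f ÷ suc N
ΣFinℚ-÷ N {zero} f = ÷-≃ 0 0 0 N refl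
ΣFinℚ-÷ N {suc m} f = begin
    f zero ÷ suc N +ℚ ΣFinℚ (λ i → f (suc i) ÷ suc N)
      ≈⟨ ℚP.+-congʳ (f zero ÷ suc N) (ΣFinℚ-÷ N (λ i → f (suc i))) ⟩
    f zero ÷ suc N +ℚ rest ÷ suc N
      ≡⟨ ÷-+ (f zero) N rest N ⟩
    (f zero * suc N + rest * suc N) ÷ (suc N * suc N)
      ≈⟨ ÷-≃ _ (N + N * suc N) (f zero + rest) N (common-denominator (f zero) rest N) ⟩
    (f zero + rest) ÷ suc N ∎
  where
  open ℚP.≃-Reasoning
  rest = ΣFin (λ i → f (suc i))
  common-denominator : ∀ a c N → (a * suc N + c * suc N) * suc N ≡ (a + c) * (suc N * suc N)
  common-denominator = solve-∀

unit-fractions-lower : ∀ {N ℓ} (o : Fin ℓ → ℕ) → 0 < N → (∀ j → 0 < o j) → (∀ j → o j ≤ N) →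
  ℓ ÷ N ≤ℚ ΣFinℚ (λ j → 1 ÷ o j)
unit-fractions-lower {suc N} {ℓ} o _ o>0 o≤N =
  ℚP.≤-respˡ-≃ (ℚP.≃-trans (ΣFinℚ-÷ N {ℓ} (λ _ → 1)) (ℚP.≃-reflexive (cong (_÷ suc N) (ΣFin-ones ℓ))))
    (ΣFinℚ-mono _ _ λ j → unit-fraction-antitone (o j) (o>0 j) (o≤N j))
  where
  unit-fraction-antitone : ∀ o → 0 < o → o ≤ suc N → 1 ÷ suc N ≤ℚ 1 ÷ o
  unit-fraction-antitone (suc o) _ o≤N = ÷-≤ 1 N 1 o (ℕP.*-monoʳ-≤ 1 o≤N)

fractions-upper : ∀ {r} (a b : Fin r → ℕ) {N} → (∀ i → 0 < b i) → 0 < N → (∀ i → b i ∣ N) →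
  ΣFinℚ (λ i → a i ÷ b i) ≤ℚ ΣFin (λ i → quot N (b i) * a i) ÷ N
fractions-upper a b {suc N} b>0 N>0 b∣N =
  ℚP.≤-respʳ-≃ (ΣFinℚ-÷ N (λ i → quot (suc N) (b i) * a i))
    (ΣFinℚ-mono _ _ λ i → ℚP.≤-reflexive (÷-expand (a i) (b>0 i) N>0 (b∣N i)))

LeastPositive : (ℕ → Set) → ℕ → Set
LeastPositive P k = 0 < k × P k × (∀ m → 0 < m → P m → k ≤ m)

search : ∀ {P : ℕ → Set} → (∀ m → Dec (P m)) → ∀ N →
  (∃ λ k → k ≤ N × LeastPositive P k) ⊎ (∀ m → 0 < m → m ≤ N → ¬ P m)
search P? zero = inj₂ λ m m>0 m≤0 _ → ℕP.<-irrefl refl (ℕP.<-≤-trans m>0 m≤0)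
search P? (suc N) with search P? N
... | inj₁ (k , k≤N , least) = inj₁ (k , ℕP.m≤n⇒m≤1+n k≤N , least)
... | inj₂ none with P? (suc N)
...   | yes P[1+N] = inj₁ (suc N , ℕP.≤-refl , s≤s z≤n , P[1+N] , above)
  where
  above : ∀ m → 0 < m → _ → suc N ≤ m
  above m m>0 Pm with m ≤? N
  ... | yes m≤N = contradiction Pm (none m m>0 m≤N)
  ... | no m≰N = ℕP.≰⇒> m≰N
...   | no ¬P[1+N] = inj₂ none′
  where
  none′ : ∀ m → 0 < m → m ≤ suc N → ¬ _
  none′ m m>0 m≤1+N with m ≤? N
  ... | yes m≤N = none m m>0 m≤N
  ... | no m≰N rewrite ℕP.≤-antisym m≤1+N (ℕP.≰⇒> m≰N) = ¬P[1+N]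

least-positive : ∀ {P : ℕ → Set} → (∀ m → Dec (P m)) → ∀ {N} → 0 < N → P N →
  ∃ λ k → k ≤ N × LeastPositive P k
least-positive P? {N} N>0 PN with search P? N
... | inj₁ witness = witness
... | inj₂ none = contradiction PN (none N N>0 ℕP.≤-refl)

module _ {r : ℕ} (n : Fin r → ℕ) where
  open Group n

  isZero? : ∀ g → Dec (IsZero g)
  isZero? g = all? (λ i → n i ∣? g i)

  -- Every element has an order, bounded by any positive common multiple N
  -- of the n_i, because N · g = 0 (IsOrder g is LeastPositive of m ↦ m · g = 0).
  order-exists : ∀ {N} → 0 < N → (∀ i → n i ∣ N) → ∀ g → ∃ λ k → k ≤ N × IsOrder g k
  order-exists N>0 n∣N g =
    least-positive (λ m → isZero? (m • g)) N>0 (λ i → ∣-trans (n∣N i) (m∣m*n (g i)))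

  ordersOf : ∀ {N} → 0 < N → (∀ i → n i ∣ N) → ∀ {ℓ} → Vec Elem ℓ → Vec ℕ ℓ
  ordersOf N>0 n∣N S = tabulate λ j → proj₁ (order-exists N>0 n∣N (lookup S j))

  ordersOf-correct : ∀ {N} (N>0 : 0 < N) (n∣N : ∀ i → n i ∣ N) {ℓ} (S : Vec Elem ℓ) →
    HasOrders S (ordersOf N>0 n∣N S) × (∀ j → lookup (ordersOf N>0 n∣N S) j ≤ N)
  ordersOf-correct {N} N>0 n∣N S = (λ j → proj₂ (orderAt j)) , (λ j → proj₁ (orderAt j))
    where
    orderAt : ∀ j → let k = lookup (ordersOf N>0 n∣N S) j in k ≤ N × IsOrder (lookup S j) k
    orderAt j rewrite lookup∘tabulate (λ j → proj₁ (order-exists N>0 n∣N (lookup S j))) j =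
      proj₂ (order-exists N>0 n∣N (lookup S j))

  zeroSum-or-zeroSumFree : ∀ {ℓ} (S : Vec Elem ℓ) →
    Σ (Subset ℓ) (λ I → Nonempty I × IsZero (subsum S I)) ⊎ ZeroSumFree S
  zeroSum-or-zeroSumFree S with anySubset? (λ I → nonempty? I ×-dec isZero? (subsum S I))
  ... | yes zeroSum = inj₁ zeroSum
  ... | no noZeroSum = inj₂ λ I I≢∅ I-zero → noZeroSum (I , I≢∅ , I-zero)

CrossNumberBound : ∀ {r} → (Fin r → ℕ) → Set
CrossNumberBound n = ∀ ℓ (S : Vec (Group.Elem n) ℓ) (ords : Vec ℕ ℓ) →
  Group.ZeroSumFree n S →
  ΣFin (λ i → n i ∸ 1) ≤ ℓ →
  Group.HasOrders n S ords →
  Group.crossOf n ords ≤ℚ ΣFinℚ (λ i → (n i ∸ 1) ÷ n i)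

weightedRank : ∀ {r} → (Fin r → ℕ) → ℕ → ℕ
weightedRank n N = ΣFin (λ i → quot N (n i) * (n i ∸ 1))

-- Σ_i (n_i - 1) ≤ T, since each weight N / n_i is positive.
rank-≤-weightedRank : ∀ {r} (n : Fin r → ℕ) {N} → (∀ i → 0 < n i) → 0 < N → (∀ i → n i ∣ N) →
  ΣFin (λ i → n i ∸ 1) ≤ weightedRank n N
rank-≤-weightedRank n n>0 N>0 n∣N = ΣFin-mono _ _ λ i →
  ℕP.m≤n*m (n i ∸ 1) _ {{>-nonZero (quot-positive (n>0 i) N>0 (n∣N i))}}

zeroSumFree-length : ∀ {r} (n : Fin r → ℕ) {N} → (∀ i → 0 < n i) → 0 < N → (∀ i → n i ∣ N) →
  CrossNumberBound n → ∀ {ℓ} (S : Vec (Group.Elem n) ℓ) → Group.ZeroSumFree n S →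
  ℓ ≤ weightedRank n N
zeroSumFree-length n {N} n>0 N>0 n∣N hyp {ℓ} S zsf with ΣFin (λ i → n i ∸ 1) ≤? ℓ
... | no short = ℕP.≤-trans (ℕP.<⇒≤ (ℕP.≰⇒> short)) (rank-≤-weightedRank n n>0 N>0 n∣N)
... | yes long = ÷-cancel ℓ (weightedRank n N) N>0 (ℚP.≤-trans cross-lower (ℚP.≤-trans cross-upper fractions))
  where
  ords = ordersOf n N>0 n∣N S
  has-orders = proj₁ (ordersOf-correct n N>0 n∣N S)
  ords≤N = proj₂ (ordersOf-correct n N>0 n∣N S)
  cross-lower : ℓ ÷ N ≤ℚ Group.crossOf n ords
  cross-lower = unit-fractions-lower (lookup ords) N>0 (λ j → proj₁ (has-orders j)) ords≤N
  cross-upper : Group.crossOf n ords ≤ℚ ΣFinℚ (λ i → (n i ∸ 1) ÷ n i)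
  cross-upper = hyp ℓ S ords zsf long has-orders
  fractions : ΣFinℚ (λ i → (n i ∸ 1) ÷ n i) ≤ℚ weightedRank n N ÷ N
  fractions = fractions-upper (λ i → n i ∸ 1) n n>0 N>0 n∣N

davenport-≤ : ∀ {r} (n : Fin r → ℕ) {N} → (∀ i → 0 < n i) → 0 < N → (∀ i → n i ∣ N) →
  CrossNumberBound n → ∀ D → Group.IsDavenport n D → D ≤ weightedRank n N + 1
davenport-≤ n {N} n>0 N>0 n∣N hyp D (_ , _ , D-least) =
  D-least (T + 1) (ℕP.m≤n+m 1 T) long-has-zeroSum
  where
  T = weightedRank n N
  long-has-zeroSum : Group.DavenportProp n (T + 1)
  long-has-zeroSum ℓ T+1≤ℓ S with zeroSum-or-zeroSumFree n S
  ... | inj₁ zeroSum = zeroSum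
  ... | inj₂ zsf = contradiction (subst (_≤ T) (ℕP.+-comm T 1) T+1≤T) (ℕP.n≮n T)
    where T+1≤T = ℕP.≤-trans T+1≤ℓ (zeroSumFree-length n n>0 N>0 n∣N hyp S zsf)

chain-divides-last : ∀ k (n : Fin (suc k) → ℕ) → (∀ (i : Fin k) → n (inject₁ i) ∣ n (Fin.suc i)) →
  ∀ i → n i ∣ n (fromℕ k)
chain-divides-last zero n chain zero = ∣-refl
chain-divides-last (suc k) n chain zero =
  ∣-trans (chain zero) (chain-divides-last k (λ i → n (suc i)) (λ i → chain (suc i)) zero)
chain-divides-last (suc k) n chain (suc i) =
  chain-divides-last k (λ i → n (suc i)) (λ i → chain (suc i)) i

proposition2p2 : (k : ℕ) (n : Fin (suc k) → ℕ) →
    (∀ i → 1 < n i) →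
    (∀ (i : Fin k) → n (inject₁ i) ∣ n (Fin.suc i)) →
    (∀ ℓ (S : Vec (Group.Elem n) ℓ) (ords : Vec ℕ ℓ) →
      Group.ZeroSumFree n S →
      ΣFin (λ i → n i ∸ 1) ≤ ℓ →
      Group.HasOrders n S ords →
      Group.crossOf n ords ≤ℚ ΣFinℚ (λ i → (n i ∸ 1) ÷ n i)) →
    ∀ D → Group.IsDavenport n D →
    D ≤ ΣFin (λ i → quot (n (fromℕ k)) (n i) * (n i ∸ 1)) + 1
proposition2p2 k n n>1 chain hyp =
  davenport-≤ n n>0 (n>0 (fromℕ k)) (chain-divides-last k n chain) hyp
  where
  n>0 : ∀ i → 0 < n i
  n>0 i = ℕP.<-trans (s≤s z≤n) (n>1 i)
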